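{- Let $G$ be a finite digraph, $k\ge 2$, $n\ge 1$, $S=\{1,\dots,n\}$ and integers $l_1,\dots,l_n\ge 1$. Let $P=[0,l_1]\times\cdots\times[0,l_n]$ with the componentwise (product) order. There exists a map $c$ from the $k$-walks of $G$ to $S$ such that for every $i\in S$, every integer $l\ge 1$ and every walk $(v_1v_2\dots v_{k+l-1})$ in $G$, the condition $c(v_1\dots v_k)=c(v_2\dots v_{k+1})=\dots=c(v_l\dots v_{k+l-1})=i$ implies $l\le l_i$, if and only if the $(k-1)$-walks of $G$ are $P$-colorable.
   Context: A digraph has finite vertex set and edges that are ordered pairs of distinct vertices; write $u\to v$ for an edge. A $k$-walk is a sequence $(v_1\dots v_k)$ with $v_1\to\dots\to v_k$; a walk is a $k$-walk for some $k$. A $P$-coloring of the $m$-walks is a map $c'$ from $m$-walks to $P$ with $c'(v_1\dots v_m)\not\le c'(v_2\dots v_{m+1})$ for every $(m+1)$-walk $(v_1\dots v_{m+1})$. -}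

module Defs where

open import Data.Nat using (ℕ; zero; suc; _+_; _≤_; _<_; z≤n; s≤s)
open import Data.Nat.Properties using (≤-trans; n≤1+n; ≤-refl)
open import Data.Fin using (Fin)
import Data.Fin as F
open import Data.Vec using (Vec; []; _∷_)
open import Data.Bool using (Bool; T)
open import Data.Unit using (⊤; tt)
open import Data.Product using (Σ; _×_; _,_; proj₁; proj₂)
open import Relation.Binary.PropositionalEquality using (_≡_)
open import Relation.Nullary using (¬_)

record Digraph : Set where
  field
    N     : ℕ
    E     : Fin N → Fin N → Bool
    irrefl : ∀ v → E v v ≡ Bool.false
  Vx : Set
  Vx = Fin N

module _ (G : Digraph) where
  open Digraph G

  IsWalk : ∀ {m} → Vec Vx m → Set
  IsWalk [] = ⊤
  IsWalk (x ∷ []) = ⊤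
  IsWalk (x ∷ y ∷ xs) = T (E x y) × IsWalk (y ∷ xs)

  Walk : ℕ → Set
  Walk m = Σ (Vec Vx m) IsWalk

  takeℓ : ∀ {L} (k : ℕ) → Vec Vx L → k ≤ L → Vec Vx k
  takeℓ zero xs p = []
  takeℓ (suc k) (x ∷ xs) (s≤s p) = x ∷ takeℓ k xs p

  slice : ∀ {L} (j k : ℕ) → Vec Vx L → j + k ≤ L → Vec Vx k
  slice zero k xs p = takeℓ k xs p
  slice (suc j) k (x ∷ xs) (s≤s p) = slice j k xs p

  takeℓ-walk : ∀ {L} (k : ℕ) (xs : Vec Vx L) (p : k ≤ L) → IsWalk xs → IsWalk (takeℓ k xs p)
  takeℓ-walk zero xs p w = tt
  takeℓ-walk (suc zero) (x ∷ xs) (s≤s p) w = tt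
  takeℓ-walk (suc (suc k)) (x ∷ y ∷ xs) (s≤s (s≤s p)) (e , w) = e , takeℓ-walk (suc k) (y ∷ xs) (s≤s p) w

  tail-walk : ∀ {L} (x : Vx) (xs : Vec Vx L) → IsWalk (x ∷ xs) → IsWalk xs
  tail-walk x [] w = tt
  tail-walk x (y ∷ xs) (e , w) = w

  slice-walk : ∀ {L} (j k : ℕ) (xs : Vec Vx L) (p : j + k ≤ L) → IsWalk xs → IsWalk (slice j k xs p)
  slice-walk zero k xs p w = takeℓ-walk k xs p w
  slice-walk (suc j) k (x ∷ xs) (s≤s p) w = slice-walk j k xs p (tail-walk x xs w)

  -- the sub-walk (v_{j+1} … v_{j+k}) of a walk, as a k-walk
  subWalk : ∀ {L} (j k : ℕ) → Walk L → j + k ≤ L → Walk k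
  subWalk j k (xs , w) p = slice j k xs p , slice-walk j k xs p w

  walkInit : ∀ {m} → Walk (suc m) → Walk m
  walkInit {m} w = subWalk 0 m w (n≤1+n m)

  walkTail : ∀ {m} → Walk (suc m) → Walk m
  walkTail {m} w = subWalk 1 m w ≤-refl

open import Data.Nat using (_∸_)
open import Data.Nat.Properties using (+-comm; +-suc; +-monoˡ-≤)
open import Relation.Binary.PropositionalEquality using (subst; sym)

window-fits : ∀ {j l} (k : ℕ) → j < l → j + k ≤ k + l ∸ 1
window-fits {j} {suc l} k (s≤s j≤l) =
  subst (λ t → j + k ≤ t ∸ 1) (sym (+-suc k l))
    (subst (λ t → j + k ≤ t) (+-comm l k) (+-monoˡ-≤ k j≤l))

-- The poset P = [0,l₁] × … × [0,lₙ] with the product order.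
PElt : ∀ {n} → (Fin n → ℕ) → Set
PElt {n} l = (i : Fin n) → Fin (suc (l i))

_≤P_ : ∀ {n} {l : Fin n → ℕ} → PElt l → PElt l → Set
_≤P_ {n} a b = ∀ (i : Fin n) → a i F.≤ b i

IsPColoring : (G : Digraph) (m : ℕ) {n : ℕ} (l : Fin n → ℕ) → (Walk G m → PElt l) → Set
IsPColoring G m l c' = ∀ (w : Walk G (suc m)) → ¬ (c' (walkInit G w) ≤P c' (walkTail G w))

PColorable : (G : Digraph) (m : ℕ) {n : ℕ} (l : Fin n → ℕ) → Set
PColorable G m l = Σ (Walk G m → PElt l) (IsPColoring G m l)

RunBounded : (G : Digraph) (k : ℕ) {n : ℕ} (ls : Fin n → ℕ) → (Walk G k → Fin n) → Set
RunBounded G k {n} ls c =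
  ∀ (i : Fin n) (l : ℕ) → 1 ≤ l → (w : Walk G (k + l ∸ 1)) →
    (∀ (j : ℕ) (p : j < l) → c (subWalk G j k w (window-fits k p)) ≡ i) →
    l ≤ ls i

{-# OPTIONS --safe #-}
module Submission where

-- A P-colouring c' of the (k-1)-walks yields a colouring of the k-walks: give a k-walk a
-- coordinate i in which c' strictly decreases from its first to its last (k-1)-subwalk.  Along a
-- run of colour i of length l the i-th coordinates of the l+1 consecutive (k-1)-windows strictly
-- decrease inside [0, lᵢ], so l ≤ lᵢ.  Conversely, given a run-bounded colouring c, let the i-th
-- coordinate of c'(u) be the length of the longest run of colour i starting at the (k-1)-walk u
-- (it is at most lᵢ).  For a k-walk w of colour i, prepending w to a longest run from the tail of
-- w gives a longer run from the head of w, so c'(head w) ≰ c'(tail w).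

open import Defs
open import Data.Nat using (ℕ; zero; suc; _+_; _≤_; _<_; _∸_; z≤n; s≤s; _<?_)
open import Data.Nat.Properties
  using (≤-refl; ≤-trans; ≤-pred; <⇒≤; <⇒≱; ≰⇒>; ≤-irrelevant; <-irrelevant; m≤m+n; m≤n⇒m≤1+n;
         m≤n⇒m<n∨m≡n; +-identityʳ; +-comm; +-suc; +-monoˡ-≤; +-monoʳ-≤; allUpTo?; module ≤-Reasoning)
open import Data.Fin using (Fin; toℕ; fromℕ<)
import Data.Fin as Fin
open import Data.Fin.Properties using (any?; ¬∀⟶∃¬; toℕ<n; toℕ-fromℕ<)
import Data.Fin.Properties as Fin
open import Data.Vec using (Vec; []; _∷_; head)
open import Data.Vec.Properties using (≡-dec)
open import Data.Bool using (T)
open import Data.Bool.Properties using (T-irrelevant)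
open import Data.Unit using (tt)
open import Data.Product using (Σ; ∃; _×_; _,_; proj₁; proj₂)
open import Data.Sum using (inj₁; inj₂)
open import Function using (_∘_)
open import Function.Bundles using (_⇔_; mk⇔)
open import Relation.Binary.Definitions using (DecidableEquality)
open import Relation.Binary.PropositionalEquality
open import Relation.Nullary using (Dec; yes; no; contradiction; Irrelevant)
open import Relation.Nullary.Decidable using (map′; _×-dec_; T?)
open import Relation.Unary using (Decidable)

any-Vec? : ∀ {N} L {P : Vec (Fin N) L → Set} → Decidable P → Dec (∃ P)
any-Vec? zero P? = map′ ([] ,_) (λ { ([] , p) → p }) (P? [])
any-Vec? (suc L) P? =
  map′ (λ { (x , xs , p) → x ∷ xs , p }) (λ { (x ∷ xs , p) → x , xs , p })
       (any? λ x → any-Vec? L (P? ∘ (x ∷_)))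

all<? : ∀ l {P : (j : ℕ) → j < l → Set} → (∀ j p → Dec (P j p)) → Dec (∀ j p → P j p)
all<? l {P} P? = map′ (λ h j p → h p p) (λ h {j} _ q → h j q) (allUpTo? below? l)
  where
  below? : Decidable (λ j → (p : j < l) → P j p)
  below? j with j <? l
  ... | yes p = map′ (λ q p′ → subst (P j) (<-irrelevant p p′) q) (λ h → h p) (P? j p)
  ... | no ¬p = yes (λ p → contradiction p ¬p)

record Greatest (P : ℕ → Set) (bound : ℕ) : Set where
  field
    value   : ℕ
    ≤bound  : value ≤ bound
    holds   : P value
    maximal : ∀ {l} → l ≤ bound → P l → l ≤ value

greatest : ∀ {P : ℕ → Set} → Decidable P → P 0 → ∀ bound → Greatest P bound
greatest P? p0 zero = record { value = 0 ; ≤bound = z≤n ; holds = p0 ; maximal = λ l≤0 _ → l≤0 }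
greatest {P} P? p0 (suc t) with P? (suc t)
... | yes p = record { value = suc t ; ≤bound = ≤-refl ; holds = p ; maximal = λ l≤ _ → l≤ }
... | no ¬p = record { value = value ; ≤bound = m≤n⇒m≤1+n ≤bound ; holds = holds ; maximal = maximal′ }
  where
  open Greatest (greatest P? p0 t)
  maximal′ : ∀ {l} → l ≤ suc t → P l → l ≤ value
  maximal′ l≤1+t pl with m≤n⇒m<n∨m≡n l≤1+t
  ... | inj₁ l<1+t = maximal (≤-pred l<1+t) pl
  ... | inj₂ refl = contradiction pl ¬p

strictlyDecreasing⇒length≤head : ∀ l (f : (j : ℕ) → j ≤ l → ℕ) →
  (∀ j (p : suc j ≤ l) q → f (suc j) p < f j q) → l ≤ f 0 z≤n
strictlyDecreasing⇒length≤head l f decreasing = ≤-trans (m≤m+n l _) (index+value≤head l ≤-refl)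
  where
  index+value≤head : ∀ j (p : j ≤ l) → j + f j p ≤ f 0 z≤n
  index+value≤head zero z≤n = ≤-refl
  index+value≤head (suc j) p = begin
    suc j + f (suc j) p    ≡⟨ +-suc j _ ⟨
    j + suc (f (suc j) p)  ≤⟨ +-monoʳ-≤ j (decreasing j p (<⇒≤ p)) ⟩
    j + f j (<⇒≤ p)        ≤⟨ index+value≤head j (<⇒≤ p) ⟩
    f 0 z≤n                ∎
    where open ≤-Reasoning

module _ (G : Digraph) where
  open Digraph G

  IsWalk-irrelevant : ∀ {m} {xs : Vec Vx m} → Irrelevant (IsWalk G xs)
  IsWalk-irrelevant {xs = []} tt tt = refl
  IsWalk-irrelevant {xs = x ∷ []} tt tt = refl
  IsWalk-irrelevant {xs = x ∷ y ∷ xs} (e , w) (e′ , w′) =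
    cong₂ _,_ (T-irrelevant e e′) (IsWalk-irrelevant w w′)

  Walk-≡ : ∀ {m} {w w′ : Walk G m} → proj₁ w ≡ proj₁ w′ → w ≡ w′
  Walk-≡ {w = xs , p} {.xs , q} refl = cong (xs ,_) (IsWalk-irrelevant p q)

  IsWalk? : ∀ {m} (xs : Vec Vx m) → Dec (IsWalk G xs)
  IsWalk? [] = yes tt
  IsWalk? (x ∷ []) = yes tt
  IsWalk? (x ∷ y ∷ xs) = T? (E x y) ×-dec IsWalk? (y ∷ xs)

  Walk-≟ : ∀ {m} → DecidableEquality (Walk G m)
  Walk-≟ w w′ = map′ Walk-≡ (cong proj₁) (≡-dec Fin._≟_ (proj₁ w) (proj₁ w′))

  any-Walk? : ∀ {m} {P : Walk G m → Set} → Decidable P → Dec (∃ P)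
  any-Walk? {m} {P} P? =
    map′ (λ { (xs , w , p) → (xs , w) , p }) (λ { ((xs , w) , p) → xs , w , p })
         (any-Vec? m along-walk?)
    where
    along-walk? : (xs : Vec Vx m) → Dec (Σ (IsWalk G xs) λ w → P (xs , w))
    along-walk? xs with IsWalk? xs
    ... | no ¬w = no (¬w ∘ proj₁)
    ... | yes w = map′ (w ,_) (λ { (w′ , p) → subst (λ w″ → P (xs , w″)) (IsWalk-irrelevant w′ w) p })
                       (P? (xs , w))

  takeℓ-all : ∀ {m} (xs : Vec Vx m) p → takeℓ G m xs p ≡ xs
  takeℓ-all [] p = refl
  takeℓ-all (x ∷ xs) (s≤s p) = cong (x ∷_) (takeℓ-all xs p)

  takeℓ-takeℓ : ∀ {L} a k (xs : Vec Vx L) p q r → takeℓ G a (takeℓ G k xs p) q ≡ takeℓ G a xs r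
  takeℓ-takeℓ zero k xs p q r = refl
  takeℓ-takeℓ (suc a) (suc k) (x ∷ xs) (s≤s p) (s≤s q) (s≤s r) = cong (x ∷_) (takeℓ-takeℓ a k xs p q r)

  slice-takeℓ : ∀ {L} a b k (xs : Vec Vx L) p q r → slice G a b (takeℓ G k xs p) q ≡ slice G a b xs r
  slice-takeℓ zero b k xs p q r = takeℓ-takeℓ b k xs p q r
  slice-takeℓ (suc a) b (suc k) (x ∷ xs) (s≤s p) (s≤s q) (s≤s r) = slice-takeℓ a b k xs p q r

  slice-slice : ∀ {L} j k a b {t} → t ≡ j + a → (xs : Vec Vx L) → ∀ p q r →
                slice G a b (slice G j k xs p) q ≡ slice G t b xs r
  slice-slice zero k a b refl xs p q r = slice-takeℓ a b k xs p q r
  slice-slice (suc j) k a b refl (x ∷ xs) (s≤s p) q (s≤s r) = slice-slice j k a b refl xs p q r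

  subWalk-all : ∀ {m} (W : Walk G m) p → subWalk G 0 m W p ≡ W
  subWalk-all W p = Walk-≡ (takeℓ-all (proj₁ W) p)

  subWalk-subst : ∀ {a b} j k (eq : a ≡ b) (W : Walk G a) p q →
                  subWalk G j k (subst (Walk G) eq W) p ≡ subWalk G j k W q
  subWalk-subst j k refl W p q = cong (subWalk G j k W) (≤-irrelevant p q)

  subWalk-subWalk : ∀ {L} j k a b {t} → t ≡ j + a → (W : Walk G L) → ∀ p q r →
                    subWalk G a b (subWalk G j k W p) q ≡ subWalk G t b W r
  subWalk-subWalk j k a b eq W p q r = Walk-≡ (slice-slice j k a b eq (proj₁ W) p q r)

  walkInit-subWalk : ∀ {L} j m (W : Walk G L) p q →
                     walkInit G (subWalk G j (suc m) W p) ≡ subWalk G j m W q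
  walkInit-subWalk j m W p q = subWalk-subWalk j (suc m) 0 m (sym (+-identityʳ j)) W p _ q

  walkTail-subWalk : ∀ {L} j m (W : Walk G L) p q →
                     walkTail G (subWalk G j (suc m) W p) ≡ subWalk G (suc j) m W q
  walkTail-subWalk j m W p q = subWalk-subWalk j (suc m) 1 m (+-comm 1 j) W p _ q

IsRun : (G : Digraph) (k : ℕ) {n : ℕ} → (Walk G k → Fin n) → Fin n → (l : ℕ) → Walk G (k + l ∸ 1) → Set
IsRun G k c i l W = ∀ j (p : j < l) → c (subWalk G j k W (window-fits k p)) ≡ i

module FromPColoring (G : Digraph) (m : ℕ) {n} {ls : Fin n → ℕ}
                     (c′ : Walk G m → PElt ls) (isP : IsPColoring G m ls c′) where

  descent : (w : Walk G (suc m)) → ∃ λ i → c′ (walkTail G w) i Fin.< c′ (walkInit G w) i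
  descent w with ¬∀⟶∃¬ n _ (λ i → c′ (walkInit G w) i Fin.≤? c′ (walkTail G w) i) (isP w)
  ... | i , ≰ = i , ≰⇒> ≰

  descentColouring : Walk G (suc m) → Fin n
  descentColouring = proj₁ ∘ descent

  descentColouring-runBounded : RunBounded G (suc m) ls descentColouring
  descentColouring-runBounded i l _ W run =
    ≤-trans (strictlyDecreasing⇒length≤head l value decreasing) (≤-pred (toℕ<n _))
    where
    value : (j : ℕ) → j ≤ l → ℕ
    value j p = toℕ (c′ (subWalk G j m W (subst (j + m ≤_) (+-comm l m) (+-monoˡ-≤ m p))) i)

    decreasing : ∀ j (p : suc j ≤ l) q → value (suc j) p < value j q
    decreasing j p q = begin-strict
      value (suc j) p                 ≡⟨ cong (λ u → toℕ (c′ u i)) (walkTail-subWalk G j m W _ _) ⟨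
      toℕ (c′ (walkTail G window) i)  <⟨ subst (λ i′ → c′ (walkTail G window) i′ Fin.< c′ (walkInit G window) i′)
                                               (run j p) (proj₂ (descent window)) ⟩
      toℕ (c′ (walkInit G window) i)  ≡⟨ cong (λ u → toℕ (c′ u i)) (walkInit-subWalk G j m W _ _) ⟩
      value j q                       ∎
      where
      open ≤-Reasoning
      window : Walk G (suc m)
      window = subWalk G j (suc m) W (window-fits (suc m) p)

pColorable⇒runBounded : (G : Digraph) (m : ℕ) {n : ℕ} (ls : Fin n → ℕ) →
  PColorable G m ls → Σ (Walk G (suc m) → Fin n) (RunBounded G (suc m) ls)
pColorable⇒runBounded G m ls (c′ , isP) = descentColouring , descentColouring-runBounded
  where open FromPColoring G m c′ isP

module FromRunBounded (G : Digraph) (m′ : ℕ) {n} {ls : Fin n → ℕ}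
                      (c : Walk G (suc (suc m′)) → Fin n) (bounded : RunBounded G (suc (suc m′)) ls c) where
  open Digraph G

  private
    m k : ℕ
    m = suc m′
    k = suc m

  -- The walk W has length m + l, which is k + l ∸ 1 definitionally, as IsRun requires.
  RunFrom : Walk G m → Fin n → ℕ → Set
  RunFrom u i l = Σ (Walk G (m + l)) λ W → subWalk G 0 m W (m≤m+n m l) ≡ u × IsRun G k c i l W

  RunFrom? : ∀ u i l → Dec (RunFrom u i l)
  RunFrom? u i l = any-Walk? G λ W →
    Walk-≟ G _ u ×-dec all<? l (λ j p → c (subWalk G j k W (window-fits k p)) Fin.≟ i)

  runFrom-zero : ∀ u i → RunFrom u i 0
  runFrom-zero u i = subst (Walk G) (sym (+-identityʳ m)) u
                   , trans (subWalk-subst G 0 m _ u _ ≤-refl) (subWalk-all G u ≤-refl)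
                   , λ _ ()

  prepend : (w : Walk G k) → ∀ {l} → RunFrom (walkTail G w) (c w) l → RunFrom (walkInit G w) (c w) (suc l)
  prepend w@(x ∷ rest@(_ ∷ _) , e , _) {l} ((y ∷ ys , walk) , start , run) = V , start′ , run′
    where
    x∷W : Walk G (suc (m + l))
    x∷W = x ∷ y ∷ ys , subst (T ∘ E x) (sym (cong (head ∘ proj₁) start)) e , walk

    V : Walk G (m + suc l)
    V = subst (Walk G) (sym (+-suc m l)) x∷W

    firstWindow : ∀ p → subWalk G 0 k V p ≡ w
    firstWindow p = trans (subWalk-subst G 0 k (sym (+-suc m l)) x∷W p (s≤s (m≤m+n m l)))
                          (Walk-≡ G (cong (x ∷_) (trans (cong proj₁ start) (takeℓ-all G rest _))))

    start′ : subWalk G 0 m V (m≤m+n m (suc l)) ≡ walkInit G w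
    start′ = trans (sym (walkInit-subWalk G 0 m V fits _)) (cong (walkInit G) (firstWindow fits))
      where
      fits : 0 + k ≤ m + suc l
      fits = window-fits k (s≤s z≤n)

    run′ : IsRun G k c (c w) (suc l) V
    run′ zero _ = cong c (firstWindow _)
    run′ (suc j) (s≤s p) =
      trans (cong c (subWalk-subst G (suc j) k (sym (+-suc m l)) x∷W _ (s≤s (window-fits k p)))) (run j p)

  longestRun : ∀ u i → Greatest (RunFrom u i) (ls i)
  longestRun u i = greatest (RunFrom? u i) (runFrom-zero u i) (ls i)

  longestRunColouring : Walk G m → PElt ls
  longestRunColouring u i = fromℕ< (s≤s (Greatest.≤bound (longestRun u i)))

  longestRunColouring-isPColoring : IsPColoring G m ls longestRunColouring
  longestRunColouring-isPColoring w head≤tail =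
    <⇒≱ longer (subst₂ _≤_ (toℕ-fromℕ< _) (toℕ-fromℕ< _) (head≤tail i))
    where
    i : Fin n
    i = c w
    open Greatest (longestRun (walkTail G w) i) using (holds) renaming (value to fromTail)
    open Greatest (longestRun (walkInit G w) i) using (maximal) renaming (value to fromHead)

    extended : RunFrom (walkInit G w) i (suc fromTail)
    extended = prepend w holds

    longer : fromTail < fromHead
    longer = maximal (bounded i (suc fromTail) (s≤s z≤n) (proj₁ extended) (proj₂ (proj₂ extended))) extended

runBounded⇒pColorable : (G : Digraph) (m′ : ℕ) {n : ℕ} (ls : Fin n → ℕ) →
  Σ (Walk G (suc (suc m′)) → Fin n) (RunBounded G (suc (suc m′)) ls) → PColorable G (suc m′) ls
runBounded⇒pColorable G m′ ls (c , bounded) = longestRunColouring , longestRunColouring-isPColoring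
  where open FromRunBounded G m′ c bounded

mainTheorem5 : (G : Digraph) (k n : ℕ) → 2 ≤ k → 1 ≤ n → (ls : Fin n → ℕ) → (∀ i → 1 ≤ ls i) →
    (Σ (Walk G k → Fin n) (RunBounded G k ls)) ⇔ PColorable G (k ∸ 1) ls
mainTheorem5 G (suc (suc m′)) n (s≤s (s≤s z≤n)) _ ls _ =
  mk⇔ (runBounded⇒pColorable G m′ ls) (pColorable⇒runBounded G (suc m′) ls)
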